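{- Let $r$ be a positive integer and let $\mathcal{H}$ be any collection of subsets of $[r]$. Then there exists $\tilde H^*\subseteq[r]$ such that for every $\tilde H\in\mathcal{H}$, $|\tilde H^*\,\Delta\,\tilde H|\le0.5r+1000\sqrt{r}\log(|\mathcal{H}|+1)$, where $\Delta$ denotes symmetric difference.
   Context: Logarithms are base 2. -}

module Defs where

open import Data.Nat using (ℕ; _+_; _*_; _∸_; _^_; _≤_)
open import Data.Fin.Subset using (Subset; _∪_; _─_; ∣_∣)
open import Data.List using (List; length)
open import Data.List.Relation.Unary.Unique.Propositional using (Unique)

_Δ_ : ∀ {r} → Subset r → Subset r → Subset r
A Δ B = (A ─ B) ∪ (B ─ A)

-- BoundHolds r m s  encodes the real inequality
--   s ≤ 0.5 r + 1000 √r log₂(m + 1)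
-- exactly, in natural numbers.  With d = 2s ∸ r and c = 2000 the inequality
-- reads d ≤ c √r log₂(m+1), i.e. 2^(d/(c√r)) ≤ m+1, which (by monotonicity and
-- continuity of 2^x and density of ℚ) holds iff for every rational p/q ≥ 0
-- with p/q ≤ d/(c√r) (⇔ p²c²r ≤ q²d²) we have 2^p ≤ (m+1)^q.
BoundHolds : ℕ → ℕ → ℕ → Set
BoundHolds r m s =
  (p q : ℕ) → 1 ≤ q →
  p * p * (2000 * 2000) * r ≤ q * q * ((2 * s ∸ r) * (2 * s ∸ r)) →
  2 ^ p ≤ (m + 1) ^ q

{-# OPTIONS --safe #-}

-- Take k with k² ≤ 2r < (k+1)² and weigh a centre x against H by
-- (k+2)^|x Δ H| · k^(r − |x Δ H|). For each H these weights sum to (2k+2)^r over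
-- all x ⊆ [r], so by averaging some x = H* has total weight at most |ℋ| (k+1)^r
-- against ℋ. For H ∈ ℋ write |H* Δ H| = A + d and r = 2A + d; then
--   ((k+2)/(k+1))^d ≤ |ℋ| · ((k+1)² / ((k+1)² − 1))^A ≤ 2|ℋ|
-- by Bernoulli's inequality, as 2A ≤ (k+1)². Since (1 + 1/(k+1))^(k+1) ≥ 2 this gives
-- 2^d ≤ (2|ℋ|)^(k+1) ≤ (|ℋ|+1)^(2k+2), i.e. d ≤ 2(k+1) log(|ℋ|+1) ≤ √(32r) log(|ℋ|+1).

module Submission where

open import Defs
open import Data.Nat using (ℕ; _≤_)
open import Data.Fin.Subset using (Subset; ∣_∣)
open import Data.List using (List; length)
open import Data.List.Membership.Propositional using (_∈_)
open import Data.List.Relation.Unary.Unique.Propositional using (Unique)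
open import Data.Product using (Σ)

open import Data.Empty using (⊥-elim)
open import Data.Fin.Subset using (∁; inside; outside)
open import Data.Fin.Subset.Properties using (∣p∣≤n; ∣∁p∣≡n∸∣p∣)
open import Data.List using ([]; _∷_; map)
open import Data.List.Membership.Propositional.Properties using (∈-map⁺)
open import Data.List.Relation.Unary.Any using (here; there)
open import Data.Nat
open import Data.Nat.ListAction using (sum)
open import Data.Nat.Properties
open import Data.Nat.Tactic.RingSolver using (solve-∀)
open import Data.Product using (∃-syntax; _,_; _×_)
open import Data.Sum using (inj₁; inj₂; [_,_]′)
open import Data.Vec using ([]; _∷_)
open import Function using (_∘_)
open import Relation.Binary.PropositionalEquality
open import Relation.Nullary using (yes; no)
open import Algebra.Properties.CommutativeSemigroup +-commutativeSemigroup using (interchange)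
open import Algebra.Properties.CommutativeSemigroup *-commutativeSemigroup using (x∙yz≈y∙xz; xy∙z≈y∙xz)

private
  variable
    n : ℕ

2*m≤n+o : ∀ {m n o} → m ≤ n → m ≤ o → 2 * m ≤ n + o
2*m≤n+o {m} m≤n m≤o = +-mono-≤ m≤n (≤-trans (≤-reflexive (+-identityʳ m)) m≤o)

^-distribʳ-* : ∀ m n o → (m * n) ^ o ≡ m ^ o * n ^ o
^-distribʳ-* m n zero    = refl
^-distribʳ-* m n (suc o) = trans (cong (m * n *_) (^-distribʳ-* m n o)) (interchange-* m n _ _)
  where
  interchange-* : ∀ a b c d → a * b * (c * d) ≡ a * c * (b * d)
  interchange-* = solve-∀

[m^n]^o≡[m^o]^n : ∀ m n o → (m ^ n) ^ o ≡ (m ^ o) ^ n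
[m^n]^o≡[m^o]^n m n o = begin
  (m ^ n) ^ o ≡⟨ ^-*-assoc m n o ⟩
  m ^ (n * o) ≡⟨ cong (m ^_) (*-comm n o) ⟩
  m ^ (o * n) ≡⟨ ^-*-assoc m o n ⟨
  (m ^ o) ^ n ∎
  where open ≡-Reasoning

^-cancelʳ-≤ : ∀ {m n} o .{{_ : NonZero o}} → m ^ o ≤ n ^ o → m ≤ n
^-cancelʳ-≤ o mᵒ≤nᵒ = ≮⇒≥ (λ n<m → <⇒≱ (^-monoˡ-< o n<m) mᵒ≤nᵒ)

m*m≤n*n⇒m≤n : ∀ {m n} → m * m ≤ n * n → m ≤ n
m*m≤n*n⇒m≤n m²≤n² = ≮⇒≥ (λ n<m → <⇒≱ (*-mono-< n<m n<m) m²≤n²)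

2*m≤[m+1]^2 : ∀ m → 2 * m ≤ (m + 1) ^ 2
2*m≤[m+1]^2 m = subst (2 * m ≤_) (expand m) (m≤m+n (2 * m) (m * m + 1))
  where
  expand : ∀ m → 2 * m + (m * m + 1) ≡ (m + 1) * ((m + 1) * 1)
  expand = solve-∀

0<[m+1]^n : ∀ m n → 0 < (m + 1) ^ n
0<[m+1]^n m n = subst (λ x → 0 < x ^ n) (+-comm 1 m) (m^n>0 (1 + m) n)

2*[m+n]∸[m+n+m]≡n : ∀ m n → 2 * (m + n) ∸ (m + n + m) ≡ n
2*[m+n]∸[m+n+m]≡n m n = trans (cong (_∸ (m + n + m)) (expand m n)) (m+n∸m≡n (m + n + m) n)
  where
  expand : ∀ m n → 2 * (m + n) ≡ m + n + m + n
  expand = solve-∀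

∃-isqrt : ∀ n → ∃[ s ] s * s ≤ n × n < suc s * suc s
∃-isqrt zero = 0 , z≤n , s≤s z≤n
∃-isqrt (suc n) with s , s²≤n , n<[1+s]² ← ∃-isqrt n with suc s * suc s ≤? suc n
... | no  [1+s]²≰1+n = s , ≤-trans s²≤n (n≤1+n n) , ≰⇒> [1+s]²≰1+n
... | yes [1+s]²≤1+n =
  suc s , [1+s]²≤1+n , ≤-<-trans n<[1+s]² (*-mono-< (n<1+n (suc s)) (n<1+n (suc s)))

∈⇒≤sum : ∀ {m ms} → m ∈ ms → m ≤ sum ms
∈⇒≤sum (here refl)  = m≤m+n _ _
∈⇒≤sum (there m∈ms) = ≤-trans (∈⇒≤sum m∈ms) (m≤n+m _ _)

bernoulli⁺ : ∀ m n → m ^ n * (m + n) ≤ m * (1 + m) ^ n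
bernoulli⁺ m zero    = ≤-reflexive (base m)
  where
  base : ∀ m → 1 * (m + 0) ≡ m * 1
  base = solve-∀
bernoulli⁺ m (suc n) = begin
  m * P * (m + suc n)           ≤⟨ m≤m+n _ (n * P) ⟩
  m * P * (m + suc n) + n * P   ≡⟨ regroup m P n ⟩
  P * (m + n) * (1 + m)         ≤⟨ *-monoˡ-≤ (1 + m) (bernoulli⁺ m n) ⟩
  m * R * (1 + m)               ≡⟨ trans (*-assoc m R (1 + m)) (cong (m *_) (*-comm R (1 + m))) ⟩
  m * ((1 + m) * R)             ∎
  where
  open ≤-Reasoning
  P R : ℕ
  P = m ^ n
  R = (1 + m) ^ n
  regroup : ∀ m P n → m * P * (m + suc n) + n * P ≡ P * (m + n) * (1 + m)
  regroup = solve-∀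

2*m^m≤[1+m]^m : ∀ m .{{_ : NonZero m}} → 2 * m ^ m ≤ (1 + m) ^ m
2*m^m≤[1+m]^m m = *-cancelˡ-≤ m (subst (_≤ m * (1 + m) ^ m) (regroup m (m ^ m)) (bernoulli⁺ m m))
  where
  regroup : ∀ m P → P * (m + m) ≡ m * (2 * P)
  regroup = solve-∀

bernoulli⁻ : ∀ m n → (1 + m) ^ n * (1 + m) ≤ m ^ n * (1 + m) + n * (1 + m) ^ n
bernoulli⁻ m zero    = ≤-reflexive (sym (+-identityʳ (1 * (1 + m))))
bernoulli⁻ m (suc n) = begin
  (1 + m) * P * (1 + m)                          ≡⟨ regroup₁ m P ⟩
  P * (1 + m) * m + P * (1 + m)                  ≤⟨ +-monoˡ-≤ (P * (1 + m)) (*-monoˡ-≤ m (bernoulli⁻ m n)) ⟩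
  (Q * (1 + m) + n * P) * m + P * (1 + m)        ≤⟨ +-monoˡ-≤ (P * (1 + m)) (m≤m+n _ (n * P)) ⟩
  (Q * (1 + m) + n * P) * m + n * P + P * (1 + m) ≡⟨ regroup₂ m P Q n ⟩
  m * Q * (1 + m) + suc n * ((1 + m) * P)        ∎
  where
  open ≤-Reasoning
  P Q : ℕ
  P = (1 + m) ^ n
  Q = m ^ n
  regroup₁ : ∀ m P → (1 + m) * P * (1 + m) ≡ P * (1 + m) * m + P * (1 + m)
  regroup₁ = solve-∀
  regroup₂ : ∀ m P Q n →
    (Q * (1 + m) + n * P) * m + n * P + P * (1 + m) ≡ m * Q * (1 + m) + suc n * ((1 + m) * P)
  regroup₂ = solve-∀

[1+m]^n≤2*m^n : ∀ m n → 2 * n ≤ 1 + m → (1 + m) ^ n ≤ 2 * m ^ n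
[1+m]^n≤2*m^n m n 2n≤1+m =
  *-cancelʳ-≤ P (2 * Q) (1 + m) (+-cancelʳ-≤ (P * (1 + m)) (P * (1 + m)) (2 * Q * (1 + m)) (begin
  P * (1 + m) + P * (1 + m)                         ≤⟨ +-mono-≤ (bernoulli⁻ m n) (bernoulli⁻ m n) ⟩
  (Q * (1 + m) + n * P) + (Q * (1 + m) + n * P)     ≡⟨ regroup Q (1 + m) n P ⟩
  2 * Q * (1 + m) + 2 * n * P                       ≤⟨ +-monoʳ-≤ (2 * Q * (1 + m)) (*-monoˡ-≤ P 2n≤1+m) ⟩
  2 * Q * (1 + m) + (1 + m) * P                     ≡⟨ cong (2 * Q * (1 + m) +_) (*-comm (1 + m) P) ⟩
  2 * Q * (1 + m) + P * (1 + m)                     ∎))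
  where
  open ≤-Reasoning
  P Q : ℕ
  P = (1 + m) ^ n
  Q = m ^ n
  regroup : ∀ Q N n P → (Q * N + n * P) + (Q * N + n * P) ≡ 2 * Q * N + 2 * n * P
  regroup = solve-∀

sumSubsets : ∀ n → (Subset n → ℕ) → ℕ
sumSubsets zero    f = f []
sumSubsets (suc n) f = sumSubsets n (f ∘ (inside ∷_)) + sumSubsets n (f ∘ (outside ∷_))

sumSubsets-0 : ∀ n → sumSubsets n (λ _ → 0) ≡ 0
sumSubsets-0 zero    = refl
sumSubsets-0 (suc n) = cong₂ _+_ (sumSubsets-0 n) (sumSubsets-0 n)

sumSubsets-+ : ∀ n (f g : Subset n → ℕ) →
  sumSubsets n (λ x → f x + g x) ≡ sumSubsets n f + sumSubsets n g
sumSubsets-+ zero    f g = refl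
sumSubsets-+ (suc n) f g = begin
  sumSubsets n (λ x → f (inside ∷ x) + g (inside ∷ x)) +
  sumSubsets n (λ x → f (outside ∷ x) + g (outside ∷ x))
    ≡⟨ cong₂ _+_ (sumSubsets-+ n _ _) (sumSubsets-+ n _ _) ⟩
  (sumSubsets n (f ∘ (inside ∷_)) + sumSubsets n (g ∘ (inside ∷_))) +
  (sumSubsets n (f ∘ (outside ∷_)) + sumSubsets n (g ∘ (outside ∷_)))
    ≡⟨ interchange (sumSubsets n (f ∘ (inside ∷_))) _ _ _ ⟩
  sumSubsets (suc n) f + sumSubsets (suc n) g ∎
  where open ≡-Reasoning

sumSubsets-* : ∀ n c (f : Subset n → ℕ) →
  sumSubsets n (λ x → c * f x) ≡ c * sumSubsets n f
sumSubsets-* zero    c f = refl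
sumSubsets-* (suc n) c f =
  trans (cong₂ _+_ (sumSubsets-* n c _) (sumSubsets-* n c _))
        (sym (*-distribˡ-+ c _ _))

sumSubsets-*-+ : ∀ n c d (f : Subset n → ℕ) →
  sumSubsets n (λ x → c * f x) + sumSubsets n (λ x → d * f x) ≡ (c + d) * sumSubsets n f
sumSubsets-*-+ n c d f =
  trans (cong₂ _+_ (sumSubsets-* n c f) (sumSubsets-* n d f))
        (sym (*-distribʳ-+ (sumSubsets n f) c d))

∃-below-average : ∀ n (f : Subset n → ℕ) → ∃[ x ] 2 ^ n * f x ≤ sumSubsets n f
∃-below-average zero    f = [] , ≤-reflexive (+-identityʳ (f []))
∃-below-average (suc n) f
  with x₁ , h₁ ← ∃-below-average n (f ∘ (inside ∷_))
     | x₀ , h₀ ← ∃-below-average n (f ∘ (outside ∷_))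
  = [ (λ S₁≤S₀ → inside  ∷ x₁ , halve (2*m≤n+o h₁ (≤-trans h₁ S₁≤S₀)))
    , (λ S₀≤S₁ → outside ∷ x₀ , halve (2*m≤n+o (≤-trans h₀ S₀≤S₁) h₀))
    ]′ (≤-total (sumSubsets n (f ∘ (inside ∷_))) (sumSubsets n (f ∘ (outside ∷_))))
  where
  halve : ∀ {y S} → 2 * (2 ^ n * y) ≤ S → 2 ^ suc n * y ≤ S
  halve {y} {S} = subst (_≤ S) (sym (*-assoc 2 (2 ^ n) y))

weight : ℕ → ℕ → Subset n → ℕ
weight a b []            = 1
weight a b (inside  ∷ v) = a * weight a b v
weight a b (outside ∷ v) = b * weight a b v

weight-closed : ∀ a b (v : Subset n) → weight a b v ≡ a ^ ∣ v ∣ * b ^ (n ∸ ∣ v ∣)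
weight-closed a b v = trans (weight-∁ v) (cong (λ e → a ^ ∣ v ∣ * b ^ e) (∣∁p∣≡n∸∣p∣ v))
  where
  weight-∁ : ∀ {n} (v : Subset n) → weight a b v ≡ a ^ ∣ v ∣ * b ^ ∣ ∁ v ∣
  weight-∁ []            = refl
  weight-∁ (inside  ∷ v) = trans (cong (a *_) (weight-∁ v)) (sym (*-assoc a _ _))
  weight-∁ (outside ∷ v) = trans (cong (b *_) (weight-∁ v)) (x∙yz≈y∙xz b (a ^ ∣ v ∣) (b ^ ∣ ∁ v ∣))

sumSubsets-weight-Δ : ∀ a b (h : Subset n) →
  sumSubsets n (λ x → weight a b (x Δ h)) ≡ (a + b) ^ n
sumSubsets-weight-Δ a b [] = refl
sumSubsets-weight-Δ {suc n} a b (inside ∷ h) =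
  trans (sumSubsets-*-+ n b a (λ x → weight a b (x Δ h)))
        (cong₂ _*_ (+-comm b a) (sumSubsets-weight-Δ a b h))
sumSubsets-weight-Δ {suc n} a b (outside ∷ h) =
  trans (sumSubsets-*-+ n a b (λ x → weight a b (x Δ h)))
        (cong ((a + b) *_) (sumSubsets-weight-Δ a b h))

potential : ℕ → ℕ → List (Subset n) → Subset n → ℕ
potential a b ℋ x = sum (map (λ h → weight a b (x Δ h)) ℋ)

weight≤potential : ∀ a b {ℋ h} (x : Subset n) → h ∈ ℋ → weight a b (x Δ h) ≤ potential a b ℋ x
weight≤potential a b x h∈ℋ = ∈⇒≤sum (∈-map⁺ (λ h → weight a b (x Δ h)) h∈ℋ)

sumSubsets-potential : ∀ a b (ℋ : List (Subset n)) →
  sumSubsets n (potential a b ℋ) ≡ length ℋ * (a + b) ^ n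
sumSubsets-potential {n} a b []      = sumSubsets-0 n
sumSubsets-potential {n} a b (h ∷ ℋ) =
  trans (sumSubsets-+ n _ _)
        (cong₂ _+_ (sumSubsets-weight-Δ a b h) (sumSubsets-potential a b ℋ))

∃-center : ∀ a b (ℋ : List (Subset n)) →
  ∃[ x ] ∀ {h} → h ∈ ℋ → 2 ^ n * weight a b (x Δ h) ≤ length ℋ * (a + b) ^ n
∃-center {n} a b ℋ with x , x-below-average ← ∃-below-average n (potential a b ℋ) =
  x , λ {h} h∈ℋ → begin
    2 ^ n * weight a b (x Δ h)      ≤⟨ *-monoʳ-≤ (2 ^ n) (weight≤potential a b x h∈ℋ) ⟩
    2 ^ n * potential a b ℋ x       ≤⟨ x-below-average ⟩
    sumSubsets n (potential a b ℋ)  ≡⟨ sumSubsets-potential a b ℋ ⟩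
    length ℋ * (a + b) ^ n          ∎
  where open ≤-Reasoning

∃-center-weight≤ : ∀ k (ℋ : List (Subset n)) →
  ∃[ x ] ∀ {h} → h ∈ ℋ → weight (2 + k) k (x Δ h) ≤ length ℋ * (1 + k) ^ n
∃-center-weight≤ {n} k ℋ with x , x-central ← ∃-center (2 + k) k ℋ =
  x , λ {h} h∈ℋ → *-cancelˡ-≤ (2 ^ n) {{m^n≢0 2 n}} (begin
    2 ^ n * weight (2 + k) k (x Δ h)      ≤⟨ x-central h∈ℋ ⟩
    length ℋ * (2 + k + k) ^ n            ≡⟨ cong (λ c → length ℋ * c ^ n) (2+k+k≡2*[1+k] k) ⟩
    length ℋ * (2 * (1 + k)) ^ n          ≡⟨ cong (length ℋ *_) (^-distribʳ-* 2 (1 + k) n) ⟩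
    length ℋ * (2 ^ n * (1 + k) ^ n)      ≡⟨ x∙yz≈y∙xz (length ℋ) (2 ^ n) _ ⟩
    2 ^ n * (length ℋ * (1 + k) ^ n)      ∎)
  where
  open ≤-Reasoning
  2+k+k≡2*[1+k] : ∀ k → 2 + k + k ≡ 2 * (1 + k)
  2+k+k≡2*[1+k] = solve-∀

[2+k]^d≤2*m*[1+k]^d : ∀ k m A d .{{_ : NonZero k}} →
  (2 + k) ^ (A + d) * k ^ A ≤ m * (1 + k) ^ (A + d + A) → 2 * A ≤ (1 + k) * (1 + k) →
  (2 + k) ^ d ≤ 2 * m * (1 + k) ^ d
[2+k]^d≤2*m*[1+k]^d k m A d weight-bound 2A≤[1+k]² =
  *-cancelʳ-≤ ((2 + k) ^ d) (2 * m * (1 + k) ^ d) Q {{m^n≢0 M A {{m*n≢0 (2 + k) k}}}} (begin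
    (2 + k) ^ d * Q                        ≡⟨ split-lhs ⟨
    (2 + k) ^ (A + d) * k ^ A              ≤⟨ weight-bound ⟩
    m * (1 + k) ^ (A + d + A)              ≡⟨ split-rhs ⟩
    m * (1 + k) ^ d * (1 + M) ^ A          ≤⟨ *-monoʳ-≤ (m * (1 + k) ^ d) ([1+m]^n≤2*m^n M A 2A≤1+M) ⟩
    m * (1 + k) ^ d * (2 * Q)              ≡⟨ regroup m ((1 + k) ^ d) Q ⟩
    2 * m * (1 + k) ^ d * Q                ∎)
  where
  open ≤-Reasoning
  M Q : ℕ
  M = (2 + k) * k
  Q = M ^ A
  1+[2+k]*k≡[1+k]² : ∀ k → 1 + (2 + k) * k ≡ (1 + k) * (1 + k)
  1+[2+k]*k≡[1+k]² = solve-∀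
  2A≤1+M : 2 * A ≤ 1 + M
  2A≤1+M = subst (2 * A ≤_) (sym (1+[2+k]*k≡[1+k]² k)) 2A≤[1+k]²
  split-lhs : (2 + k) ^ (A + d) * k ^ A ≡ (2 + k) ^ d * Q
  split-lhs = begin-equality
    (2 + k) ^ (A + d) * k ^ A              ≡⟨ cong (_* k ^ A) (^-distribˡ-+-* (2 + k) A d) ⟩
    (2 + k) ^ A * (2 + k) ^ d * k ^ A      ≡⟨ xy∙z≈y∙xz ((2 + k) ^ A) ((2 + k) ^ d) (k ^ A) ⟩
    (2 + k) ^ d * ((2 + k) ^ A * k ^ A)    ≡⟨ cong ((2 + k) ^ d *_) (^-distribʳ-* (2 + k) k A) ⟨
    (2 + k) ^ d * Q                        ∎
  split-rhs : m * (1 + k) ^ (A + d + A) ≡ m * (1 + k) ^ d * (1 + M) ^ A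
  split-rhs = begin-equality
    m * K ^ (A + d + A)                    ≡⟨ cong (m *_) (^-distribˡ-+-* K (A + d) A) ⟩
    m * (K ^ (A + d) * K ^ A)              ≡⟨ cong (λ x → m * (x * K ^ A)) (^-distribˡ-+-* K A d) ⟩
    m * (K ^ A * K ^ d * K ^ A)            ≡⟨ regroup′ m (K ^ A) (K ^ d) ⟩
    m * K ^ d * (K ^ A * K ^ A)            ≡⟨ cong (m * K ^ d *_) (^-distribʳ-* K K A) ⟨
    m * K ^ d * (K * K) ^ A                ≡⟨ cong (λ x → m * K ^ d * x ^ A) (1+[2+k]*k≡[1+k]² k) ⟨
    m * K ^ d * (1 + M) ^ A                ∎
    where
    K : ℕ
    K = 1 + k
    regroup′ : ∀ m a b → m * (a * b * a) ≡ m * b * (a * a)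
    regroup′ = solve-∀
  regroup : ∀ m x Q → m * x * (2 * Q) ≡ 2 * m * x * Q
  regroup = solve-∀

2^d≤c^m : ∀ m c d .{{_ : NonZero m}} → (1 + m) ^ d ≤ c * m ^ d → 2 ^ d ≤ c ^ m
2^d≤c^m m c d [1+m]^d≤c*m^d =
  *-cancelʳ-≤ (2 ^ d) (c ^ m) ((m ^ d) ^ m) {{m^n≢0 (m ^ d) m {{m^n≢0 m d}}}} (begin
  2 ^ d * (m ^ d) ^ m     ≡⟨ cong (2 ^ d *_) ([m^n]^o≡[m^o]^n m d m) ⟩
  2 ^ d * (m ^ m) ^ d     ≡⟨ ^-distribʳ-* 2 (m ^ m) d ⟨
  (2 * m ^ m) ^ d         ≤⟨ ^-monoˡ-≤ d (2*m^m≤[1+m]^m m) ⟩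
  ((1 + m) ^ m) ^ d       ≡⟨ [m^n]^o≡[m^o]^n (1 + m) m d ⟩
  ((1 + m) ^ d) ^ m       ≤⟨ ^-monoˡ-≤ m [1+m]^d≤c*m^d ⟩
  (c * m ^ d) ^ m         ≡⟨ ^-distribʳ-* c (m ^ d) m ⟩
  c ^ m * (m ^ d) ^ m     ∎)
  where open ≤-Reasoning

excess-bound : ∀ k m r B .{{_ : NonZero k}} → B ≤ r → 2 * r ≤ (1 + k) * (1 + k) →
  (2 + k) ^ B * k ^ (r ∸ B) ≤ m * (1 + k) ^ r → 2 ^ (2 * B ∸ r) ≤ (m + 1) ^ (2 * (1 + k))
excess-bound k m r B B≤r 2r≤[1+k]² weight-bound with m≤n⇒∃[o]m+o≡n B≤r
... | A , refl with ≤-total A B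
...   | inj₂ B≤A rewrite m≤n⇒m∸n≡0 (2*m≤n+o ≤-refl B≤A) = 0<[m+1]^n m (2 * (1 + k))
...   | inj₁ A≤B with m≤n⇒∃[o]m+o≡n A≤B
...     | d , refl rewrite 2*[m+n]∸[m+n+m]≡n A d | m+n∸m≡n (A + d) A = begin
  2 ^ d                        ≤⟨ 2^d≤c^m (1 + k) (2 * m) d [2+k]^d≤2*m*[1+k]^d′ ⟩
  (2 * m) ^ (1 + k)            ≤⟨ ^-monoˡ-≤ (1 + k) (2*m≤[m+1]^2 m) ⟩
  ((m + 1) ^ 2) ^ (1 + k)      ≡⟨ ^-*-assoc (m + 1) 2 (1 + k) ⟩
  (m + 1) ^ (2 * (1 + k))      ∎
  where
  open ≤-Reasoning
  2A≤[1+k]² : 2 * A ≤ (1 + k) * (1 + k)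
  2A≤[1+k]² = ≤-trans (*-monoʳ-≤ 2 (m≤n+m A (A + d))) 2r≤[1+k]²
  [2+k]^d≤2*m*[1+k]^d′ : (2 + k) ^ d ≤ 2 * m * (1 + k) ^ d
  [2+k]^d≤2*m*[1+k]^d′ = [2+k]^d≤2*m*[1+k]^d k m A d weight-bound 2A≤[1+k]²

-- p/q ≤ D/√X ≤ D/u, so b^(p/q) ≤ b^(D/u) ≤ N.
^-bound-from-rational : ∀ {b N D u X} .{{_ : NonZero b}} .{{_ : NonZero u}} →
  u * u ≤ X → b ^ D ≤ N ^ u → ∀ p q → p * p * X ≤ q * q * (D * D) → b ^ p ≤ N ^ q
^-bound-from-rational {b} {N} {D} {u} {X} u²≤X bᴰ≤Nᵘ p q p²X≤q²D² = ^-cancelʳ-≤ u (begin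
  (b ^ p) ^ u       ≡⟨ ^-*-assoc b p u ⟩
  b ^ (p * u)       ≤⟨ ^-monoʳ-≤ b pu≤qD ⟩
  b ^ (q * D)       ≡⟨ cong (b ^_) (*-comm q D) ⟩
  b ^ (D * q)       ≡⟨ ^-*-assoc b D q ⟨
  (b ^ D) ^ q       ≤⟨ ^-monoˡ-≤ q bᴰ≤Nᵘ ⟩
  (N ^ u) ^ q       ≡⟨ [m^n]^o≡[m^o]^n N u q ⟩
  (N ^ q) ^ u       ∎)
  where
  open ≤-Reasoning
  square-* : ∀ m n → m * n * (m * n) ≡ m * m * (n * n)
  square-* = solve-∀
  pu≤qD : p * u ≤ q * D
  pu≤qD = m*m≤n*n⇒m≤n (begin
    p * u * (p * u)   ≡⟨ square-* p u ⟩
    p * p * (u * u)   ≤⟨ *-monoʳ-≤ (p * p) u²≤X ⟩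
    p * p * X         ≤⟨ p²X≤q²D² ⟩
    q * q * (D * D)   ≡⟨ square-* q D ⟨
    q * D * (q * D)   ∎)

2^excess≤⇒BoundHolds : ∀ r m s u .{{_ : NonZero u}} →
  u * u ≤ 2000 * 2000 * r → 2 ^ (2 * s ∸ r) ≤ (m + 1) ^ u → BoundHolds r m s
2^excess≤⇒BoundHolds r m s u u²≤ 2^excess≤ p q _ p²C²r≤q²D² =
  ^-bound-from-rational {D = D} u²≤ 2^excess≤ p q
    (subst (_≤ q * q * (D * D)) (*-assoc (p * p) (2000 * 2000) r) p²C²r≤q²D²)
  where
  D : ℕ
  D = 2 * s ∸ r

[2*[1+k]]²≤2000²*r : ∀ k r .{{_ : NonZero k}} →
  k * k ≤ 2 * r → 2 * (1 + k) * (2 * (1 + k)) ≤ 2000 * 2000 * r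
[2*[1+k]]²≤2000²*r k r k²≤2r = begin
  2 * (1 + k) * (2 * (1 + k))     ≤⟨ *-mono-≤ 2[1+k]≤4k 2[1+k]≤4k ⟩
  2 * (2 * k) * (2 * (2 * k))     ≡⟨ expand k ⟩
  16 * (k * k)                    ≤⟨ *-monoʳ-≤ 16 k²≤2r ⟩
  16 * (2 * r)                    ≡⟨ *-assoc 16 2 r ⟨
  32 * r                          ≤⟨ *-monoˡ-≤ r (≤ᵇ⇒≤ 32 (2000 * 2000) _) ⟩
  2000 * 2000 * r                 ∎
  where
  open ≤-Reasoning
  2[1+k]≤4k : 2 * (1 + k) ≤ 2 * (2 * k)
  2[1+k]≤4k = *-monoʳ-≤ 2 (+-mono-≤ (>-nonZero⁻¹ k) (m≤m+n k 0))
  expand : ∀ k → 2 * (2 * k) * (2 * (2 * k)) ≡ 16 * (k * k)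
  expand = solve-∀

lemma30 : (r : ℕ) → 1 ≤ r → (ℋ : List (Subset r)) → Unique ℋ →
    Σ (Subset r) (λ H* → (H : Subset r) → H ∈ ℋ →
      BoundHolds r (length ℋ) ∣ H* Δ H ∣)
lemma30 r 1≤r ℋ _ with ∃-isqrt (2 * r)
... | zero , _ , 2r<1 = ⊥-elim (<⇒≱ 2r<1 (≤-trans 1≤r (m≤m+n r (r + 0))))
... | k@(suc _) , k²≤2r , 2r<[1+k]²
  with H* , H*-central ← ∃-center-weight≤ k ℋ =
  H* , λ H H∈ℋ →
    2^excess≤⇒BoundHolds r (length ℋ) ∣ H* Δ H ∣ (2 * (1 + k))
      ([2*[1+k]]²≤2000²*r k r k²≤2r)
      (excess-bound k (length ℋ) r ∣ H* Δ H ∣ (∣p∣≤n (H* Δ H)) (<⇒≤ 2r<[1+k]²)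
        (subst (_≤ length ℋ * (1 + k) ^ r) (weight-closed (2 + k) k (H* Δ H)) (H*-central H∈ℋ)))
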